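{- Let $l=5$, $r\in\{1,2\}$, $a=[r]$ and $b=[2r]$. Then $p_{8,0}(1/a)=b^{16}$.
   Context: For an integer $i$, $[i]=\sum x^{n^2}\in\mathbb{Z}/2[[x]]$, summed over $n\in\mathbb{Z}$ with $n\equiv i\pmod 5$. $1/a$ is taken in the field $L$ of Laurent series over $\mathbb{Z}/2$. For $q$ a power of $2$ and $0\le j<q$, $p_{q,j}:L\to L$ is $\sum_n c_nx^n\mapsto\sum_{n\equiv j\pmod q}c_nx^n$ (the projection onto $x^jL^{q}$ in $L=\bigoplus_{0\le j<q}x^jL^{q}$, $L^{q}$ the subfield of $q$th powers). -}

module Defs where

open import Data.Bool using (Bool; true; false; _∧_; _xor_)
open import Data.Nat as ℕ using (ℕ; zero; suc; _∸_; _≡ᵇ_; NonZero)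
open import Data.Integer as ℤ using (ℤ; +_; -[1+_]; ∣_∣; _%ℕ_)
open import Data.List using (List; foldr; map; upTo)

-- Formal power series over Z/2: coefficient functions ℕ → Bool
-- (true = 1, false = 0; addition is xor).
PS : Set
PS = ℕ → Bool

LS : Set
LS = ℤ → Bool

xorSum : List Bool → Bool
xorSum = foldr _xor_ false

_⊛_ : PS → PS → PS
(f ⊛ g) n = xorSum (map (λ i → f i ∧ g (n ∸ i)) (upTo (suc n)))

onePS : PS
onePS zero    = true
onePS (suc _) = false

_^ᵖ_ : PS → ℕ → PS
f ^ᵖ zero  = onePS
f ^ᵖ suc k = f ⊛ (f ^ᵖ k)

X^ : ℕ → PS
X^ m n = n ≡ᵇ m

-- [i] = Σ_{n ∈ ℤ, n ≡ i mod 5} x^(n^2).  The coefficient of x^k is the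
-- parity of #{n ∈ ℤ : n ≡ i (mod 5), n^2 = k}; such n satisfy |n| ≤ k,
-- so we sum over n = -k, ..., k.
theta : ℤ → PS
theta i k = xorSum (map term (upTo (suc (2 ℕ.* k))))
  where
  term : ℕ → Bool
  term j = let n = (+ j) ℤ.- (+ k) in
           (((n ℤ.- i) %ℕ 5) ≡ᵇ 0) ∧ ((∣ n ∣ ℕ.* ∣ n ∣) ≡ᵇ k)

psToLS : PS → LS
psToLS f (+ k)      = f k
psToLS f -[1+ _ ]   = false

-- the Laurent series x^(-m) · f
shiftLS : ℕ → PS → LS
shiftLS m f e = psToLS f (e ℤ.+ (+ m))

proj : (q : ℕ) → .{{NonZero q}} → ℕ → LS → LS
proj q j c e = ((e %ℕ q) ≡ᵇ j) ∧ c e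

-- Over 𝔽₂ squaring is additive, so the even part Ev h (n) = h (2n) of a series satisfies
-- Ev (g² h) = g · Ev h: each application of Ev extracts one square root.  With a = [r],
-- b = [2r] and 1/a = x⁻ᵐ f, where a f = xᵐ, the two theta identities
--   Ev a = b²     (n² = 4k forces n = 2n′, and n ≡ r ⇔ −n′ ≡ 2r (mod 5)),
--   Ev (ab) = ab  ((u, v) ↦ (v − u, −u − v) doubles u² + v² and respects the residues)
-- give Ev³ (x⁷ᵐ f) = Ev³ ((af)⁷ f) = Ev³ ((a³f⁴)² a) = Ev² (a³f⁴ b²) = Ev² ((af²b)² a)
--      = Ev (af²b · b²) = Ev ((fb)² · ab) = fb · ab = af · b² = xᵐ b².
-- Hence the coefficient of x^(8q) in x⁻ᵐ f is that of x^q in b², i.e. that of x^(8q) in b¹⁶,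
-- while b¹⁶ has no other terms.  The theta identities are proved by reindexing the finite
-- xor-sums defining the coefficients along bijections between their supports.
module Submission where

open import Defs
open import Data.Nat using (ℕ; _*_)
open import Data.Integer using (ℤ; +_)
open import Data.Sum using (_⊎_)
open import Relation.Binary.PropositionalEquality using (_≡_)

open import Algebra.Bundles using (CommutativeMonoid; CommutativeRing)
open import Data.Bool using (Bool; true; false; T; _∧_; _xor_)
open import Data.Bool.Properties
  using (xor-assoc; xor-comm; xor-same; xor-identityʳ; xor-∧-commutativeRing; ∧-comm; ∧-assoc; ∧-idem;
         ∧-zeroʳ; ∧-identityʳ; ∧-distribˡ-xor; T-∧; T-≡; ⇔→≡)
open import Data.Empty using (⊥-elim)
open import Data.Integer as ℤ using (-[1+_]; ∣_∣; _%ℕ_; _/ℕ_)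
open import Data.Integer.DivMod using (a≡a%ℕn+[a/ℕn]*n)
open import Data.Integer.Divisibility.Signed using (_∣_; divides; ∣-refl; ∣m∣n⇒∣m+n; ∣n⇒∣m*n; ∣ᵤ⇒∣; ∣⇒∣ᵤ)
import Data.Integer.Properties as ℤ
open import Data.Integer.Tactic.RingSolver using (solve-∀)
open import Data.List using (List; []; _∷_; _++_; map; upTo; cartesianProduct)
open import Data.List.Properties using (map-∘)
open import Data.List.Membership.Propositional using (_∈_)
open import Data.List.Membership.Propositional.Properties using (∈-map⁺; ∈-upTo⁺; ∈-upTo⁻; ∈-cartesianProduct⁺)
open import Data.List.Relation.Unary.Any using (here; there)
open import Data.List.Relation.Unary.Unique.Propositional using (Unique; _∷_)
open import Data.List.Relation.Unary.Unique.Propositional.Properties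
  using (Unique[x∷xs]⇒x∉xs; map⁺; upTo⁺; cartesianProduct⁺)
open import Data.Nat as ℕ using (zero; suc; _+_; _∸_; _≤_; _<_; s≤s; z≤n; _≡ᵇ_; _<ᵇ_; _≤ᵇ_)
open import Data.Nat.DivMod using (_%_)
open import Data.Nat.Divisibility using (n∣m⇒m%n≡0) renaming (_∣_ to _∣ℕ_)
open import Data.Nat.Primality using (euclidsLemma; prime[2])
open import Data.Nat.Properties
import Data.Nat.Tactic.RingSolver as ℕ-Solver
open import Data.Product using (∃-syntax; _×_; _,_; proj₁; proj₂; uncurry)
open import Data.Product.Properties using (≡-dec; ,-injective)
open import Data.Sum using (inj₁; inj₂)
open import Function using (_∘_; _∘′_; _⇔_; mk⇔; Equivalence)
open import Level using (0ℓ)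
open import Relation.Binary.Definitions using (DecidableEquality)
open import Relation.Binary.PropositionalEquality
  using (_≢_; refl; sym; trans; cong; cong₂; subst; subst₂; module ≡-Reasoning)
import Relation.Binary.Reasoning.Setoid as SetoidReasoning
open import Relation.Nullary using (¬_; yes; no; contradiction)
open import Relation.Nullary.Decidable using (⌊_⌋; toWitness; fromWitness)
open import Algebra.Properties.CommutativeSemigroup
  (CommutativeRing.+-commutativeSemigroup xor-∧-commutativeRing) using (interchange)

private variable
  A B : Set

¬T⇒≡false : ∀ {b} → ¬ T b → b ≡ false
¬T⇒≡false {true}  ¬b = ⊥-elim (¬b _)
¬T⇒≡false {false} _  = refl

T⇒≡true : ∀ {b} → T b → b ≡ true
T⇒≡true = Equivalence.to T-≡

T-∧⁻ : ∀ a {b} → T (a ∧ b) → T a × T b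
T-∧⁻ true t = _ , t

T⇔T⇒≡ : ∀ {a b} → (T a ⇔ T b) → a ≡ b
T⇔T⇒≡ {a} {b} a⇔b = ⇔→≡ {z = true} (mk⇔ (to T-≡ ∘ to a⇔b ∘ from T-≡) (to T-≡ ∘ from a⇔b ∘ from T-≡))
  where open Equivalence

double-≤-cancel : ∀ {m n} → m + m ≤ n + n → m ≤ n
double-≤-cancel m+m≤n+n = ≮⇒≥ (λ n<m → <⇒≱ (+-mono-< n<m n<m) m+m≤n+n)

double-injective : ∀ {m n} → m + m ≡ n + n → m ≡ n
double-injective eq = ≤-antisym (double-≤-cancel (≤-reflexive eq)) (double-≤-cancel (≤-reflexive (sym eq)))

double-∸ : ∀ m n → (m + m) ∸ (n + n) ≡ (m ∸ n) + (m ∸ n)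
double-∸ m       zero    = refl
double-∸ zero    (suc n) = refl
double-∸ (suc m) (suc n) rewrite +-suc m m | +-suc n n = double-∸ m n

double≢suc-double : ∀ m n → m + m ≢ suc (n + n)
double≢suc-double m n eq =
  even≢odd m n (subst₂ (λ a b → m + a ≡ suc (n + b)) (sym (+-identityʳ m)) (sym (+-identityʳ n)) eq)

parity : ∀ n → ∃[ k ] (n ≡ k + k ⊎ n ≡ suc (k + k))
parity zero = 0 , inj₁ refl
parity (suc n) with parity n
... | k , inj₁ refl = k , inj₂ refl
... | k , inj₂ refl = suc k , inj₁ (cong suc (sym (+-suc k k)))

trichotomyᵇ : ∀ m n → (m <ᵇ n) xor ((m ≡ᵇ n) xor (n <ᵇ m)) ≡ true
trichotomyᵇ zero    zero    = refl
trichotomyᵇ zero    (suc n) = refl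
trichotomyᵇ (suc m) zero    = refl
trichotomyᵇ (suc m) (suc n) = trichotomyᵇ m n

≡ᵇ-double : ∀ m n → (m + m ≡ᵇ n + n) ≡ (m ≡ᵇ n)
≡ᵇ-double m n = T⇔T⇒≡ (mk⇔ (≡⇒≡ᵇ m n ∘ double-injective ∘ ≡ᵇ⇒≡ _ _) (≡⇒≡ᵇ _ _ ∘ cong (λ k → k + k) ∘ ≡ᵇ⇒≡ m n))

≡ᵇ-∸ : ∀ {a N} b → a ≤ N → (b ≡ᵇ N ∸ a) ≡ (a + b ≡ᵇ N)
≡ᵇ-∸ {a} {N} b a≤N = T⇔T⇒≡ (mk⇔ (λ t → ≡⇒≡ᵇ _ N (trans (cong (λ x → a + x) (≡ᵇ⇒≡ b _ t)) (m+[n∸m]≡n a≤N)))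
                                 (λ t → ≡⇒≡ᵇ b _ (trans (sym (m+n∸m≡n a b)) (cong (_∸ a) (≡ᵇ⇒≡ _ N t)))))

-- Xor-sums over lists

-- Opaque, so that unification sees ⨁ xs h instead of its unfolding into foldr.
opaque
  ⨁ : List A → (A → Bool) → Bool
  ⨁ xs h = xorSum (map h xs)

  syntax ⨁ xs (λ x → e) = ⨁[ x ∈ xs ] e

  ⨁-cong : ∀ {xs : List A} {g h} → (∀ {x} → x ∈ xs → g x ≡ h x) → ⨁ xs g ≡ ⨁ xs h
  ⨁-cong {xs = []}     _   = refl
  ⨁-cong {xs = x ∷ xs} g≡h = cong₂ _xor_ (g≡h (here refl)) (⨁-cong (g≡h ∘ there))

  ⨁-++ : ∀ (xs ys : List A) h → ⨁ (xs ++ ys) h ≡ ⨁ xs h xor ⨁ ys h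
  ⨁-++ []       ys h = refl
  ⨁-++ (x ∷ xs) ys h = trans (cong (h x xor_) (⨁-++ xs ys h)) (sym (xor-assoc (h x) _ _))

  ⨁-map : ∀ (f : A → B) xs h → ⨁ (map f xs) h ≡ ⨁ xs (h ∘ f)
  ⨁-map f xs h = cong xorSum (sym (map-∘ xs))

  ⨁-false : ∀ {xs : List A} {h} → (∀ {x} → x ∈ xs → ¬ T (h x)) → ⨁ xs h ≡ false
  ⨁-false {xs = xs} {h} h≢ = trans (⨁-cong (¬T⇒≡false ∘ h≢)) (all-false xs)
    where
    all-false : ∀ (xs : List A) → ⨁[ x ∈ xs ] false ≡ false
    all-false []       = refl
    all-false (_ ∷ xs) = all-false xs

  ⨁-xor : ∀ (xs : List A) g h → ⨁[ x ∈ xs ] (g x xor h x) ≡ ⨁ xs g xor ⨁ xs h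
  ⨁-xor []       g h = refl
  ⨁-xor (x ∷ xs) g h = trans (cong ((g x xor h x) xor_) (⨁-xor xs g h)) (interchange (g x) (h x) _ _)

  ⨁-∧ˡ : ∀ (xs : List A) b h → ⨁[ x ∈ xs ] (b ∧ h x) ≡ b ∧ ⨁ xs h
  ⨁-∧ˡ []       b h = sym (∧-zeroʳ b)
  ⨁-∧ˡ (x ∷ xs) b h = trans (cong ((b ∧ h x) xor_) (⨁-∧ˡ xs b h)) (sym (∧-distribˡ-xor b (h x) _))

  ⨁-∧ʳ : ∀ (xs : List A) b h → ⨁[ x ∈ xs ] (h x ∧ b) ≡ ⨁ xs h ∧ b
  ⨁-∧ʳ xs b h = trans (⨁-cong {xs = xs} (λ {x} _ → ∧-comm (h x) b)) (trans (⨁-∧ˡ xs b h) (∧-comm b _))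

  ⨁-∧-⨁ : ∀ (xs : List A) (ys : List B) g h →
          ⨁ xs g ∧ ⨁ ys h ≡ ⨁[ x ∈ xs ] ⨁[ y ∈ ys ] (g x ∧ h y)
  ⨁-∧-⨁ xs ys g h = trans (sym (⨁-∧ʳ xs (⨁ ys h) g)) (⨁-cong {xs = xs} (λ {x} _ → sym (⨁-∧ˡ ys (g x) h)))

  ⨁-comm : ∀ (xs : List A) (ys : List B) (h : A → B → Bool) →
           ⨁[ x ∈ xs ] ⨁[ y ∈ ys ] h x y ≡ ⨁[ y ∈ ys ] ⨁[ x ∈ xs ] h x y
  ⨁-comm []       ys h = sym (⨁-false {xs = ys} (λ _ ()))
  ⨁-comm (x ∷ xs) ys h = trans (cong (⨁ ys (h x) xor_) (⨁-comm xs ys h)) (sym (⨁-xor ys (h x) _))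

  ⨁-cartesianProduct : ∀ (xs : List A) (ys : List B) h →
    ⨁ (cartesianProduct xs ys) h ≡ ⨁[ x ∈ xs ] ⨁[ y ∈ ys ] h (x , y)
  ⨁-cartesianProduct []       ys h = refl
  ⨁-cartesianProduct (x ∷ xs) ys h = begin
    ⨁ (map (x ,_) ys ++ cartesianProduct xs ys) h          ≡⟨ ⨁-++ (map (x ,_) ys) _ h ⟩
    ⨁ (map (x ,_) ys) h xor ⨁ (cartesianProduct xs ys) h ≡⟨ cong₂ _xor_ (⨁-map (x ,_) ys h) (⨁-cartesianProduct xs ys h) ⟩
    ⨁[ y ∈ ys ] h (x , y) xor ⨁[ x ∈ xs ] ⨁[ y ∈ ys ] h (x , y) ∎
    where open ≡-Reasoning

  ⨁-xorSum : ∀ (xs : List A) h → xorSum (map h xs) ≡ ⨁ xs h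
  ⨁-xorSum xs h = refl

  ⨁-∷ : ∀ x (xs : List A) h → ⨁ (x ∷ xs) h ≡ h x xor ⨁ xs h
  ⨁-∷ x xs h = refl

⨁-single : ∀ {xs : List A} {h} c → Unique xs → (T (h c) → c ∈ xs) →
           (∀ {x} → x ∈ xs → T (h x) → x ≡ c) → ⨁ xs h ≡ h c
⨁-single {xs = xs} {h} c !xs c∈xs only-c with h c in hc
... | true  = trans (single-∈ !xs (c∈xs _) only-c) hc
  where
  single-∈ : ∀ {xs} → Unique xs → c ∈ xs → (∀ {x} → x ∈ xs → T (h x) → x ≡ c) → ⨁ xs h ≡ h c
  single-∈ {x ∷ xs} !x∷xs (here refl) only-c = trans (⨁-∷ x xs h) (trans
    (cong (h x xor_) (⨁-false λ y∈xs hy → Unique[x∷xs]⇒x∉xs !x∷xs (subst (_∈ xs) (only-c (there y∈xs) hy) y∈xs)))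
    (xor-identityʳ (h x)))
  single-∈ {x ∷ xs} !x∷xs@(_ ∷ !xs) (there c∈xs) only-c = trans (⨁-∷ x xs h) (trans
    (cong (_xor ⨁ xs h) (¬T⇒≡false λ hx → Unique[x∷xs]⇒x∉xs !x∷xs (subst (_∈ xs) (sym (only-c (here refl) hx)) c∈xs)))
    (single-∈ !xs c∈xs (only-c ∘ there)))
... | false = ⨁-false λ x∈xs hx → subst T hc (subst (T ∘ h) (only-c x∈xs hx) hx)

⨁-reindex : ∀ {A B : Set} {xs : List A} {ys : List B} {F : A → Bool} → DecidableEquality A → (φ : B → A) →
  Unique xs → Unique ys →
  (∀ {y y′} → y ∈ ys → y′ ∈ ys → φ y ≡ φ y′ → y ≡ y′) →
  (∀ {y} → y ∈ ys → T (F (φ y)) → φ y ∈ xs) →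
  (∀ {x} → x ∈ xs → T (F x) → ∃[ y ] y ∈ ys × φ y ≡ x) →
  ⨁ ys (F ∘ φ) ≡ ⨁ xs F
⨁-reindex {A} {B} {xs} {ys} {F} _≟_ φ !xs !ys φ-injective φ∈xs onto = begin
  ⨁ ys (F ∘ φ)                   ≡⟨ ⨁-cong column ⟨
  ⨁[ y ∈ ys ] ⨁[ x ∈ xs ] H x y  ≡⟨ ⨁-comm ys xs (λ y x → H x y) ⟩
  ⨁[ x ∈ xs ] ⨁[ y ∈ ys ] H x y  ≡⟨ ⨁-cong row ⟩
  ⨁ xs F                         ∎
  where
  open ≡-Reasoning
  H : A → B → Bool
  H x y = F x ∧ ⌊ x ≟ φ y ⌋

  ≟-refl : ∀ a → ⌊ a ≟ a ⌋ ≡ true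
  ≟-refl a = T⇒≡true (fromWitness refl)

  column : ∀ {y} → y ∈ ys → ⨁[ x ∈ xs ] H x y ≡ F (φ y)
  column {y} y∈ys = trans (⨁-single (φ y) !xs (φ∈xs y∈ys ∘ proj₁ ∘ T-∧⁻ (F (φ y))) (λ {x} _ → toWitness ∘ proj₂ ∘ T-∧⁻ (F x)))
                          (trans (cong (F (φ y) ∧_) (≟-refl (φ y))) (∧-identityʳ (F (φ y))))

  row : ∀ {x} → x ∈ xs → ⨁[ y ∈ ys ] H x y ≡ F x
  row {x} x∈xs with F x in Fx
  ... | false = ⨁-false {xs = ys} {λ y → false ∧ ⌊ x ≟ φ y ⌋} λ _ ()
  ... | true with onto x∈xs (subst T (sym Fx) _)
  ...   | y₀ , y₀∈ys , refl = trans
    (⨁-single {xs = ys} {λ y → true ∧ ⌊ φ y₀ ≟ φ y ⌋} y₀ !ys (λ _ → y₀∈ys) (λ y∈ys hy → φ-injective y∈ys y₀∈ys (sym (toWitness hy))))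
    (≟-refl (φ y₀))

⨁-support : ∀ {A : Set} {xs ys : List A} {h : A → Bool} → DecidableEquality A → Unique xs → Unique ys →
            (∀ {x} → x ∈ ys → T (h x) → x ∈ xs) → (∀ {x} → x ∈ xs → T (h x) → x ∈ ys) →
            ⨁ ys h ≡ ⨁ xs h
⨁-support _≟_ !xs !ys ys⊆xs xs⊆ys = ⨁-reindex _≟_ (λ x → x) !xs !ys (λ _ _ eq → eq) ys⊆xs (λ x∈ hx → _ , xs⊆ys x∈ hx , refl)

⨁-upTo-reflect : ∀ n (F : ℕ → Bool) → ⨁[ i ∈ upTo (suc n) ] F (n ∸ i) ≡ ⨁ (upTo (suc n)) F
⨁-upTo-reflect n F = ⨁-reindex _≟_ (n ∸_) (upTo⁺ _) (upTo⁺ _) inj (λ {i} _ _ → ∈-upTo⁺ (s≤s (m∸n≤m n i)))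
  (λ {i} i∈ _ → n ∸ i , ∈-upTo⁺ (s≤s (m∸n≤m n i)) , m∸[m∸n]≡n (≤-pred (∈-upTo⁻ i∈)))
  where
  inj : ∀ {i j} → i ∈ upTo (suc n) → j ∈ upTo (suc n) → n ∸ i ≡ n ∸ j → i ≡ j
  inj {i} {j} i∈ j∈ eq = trans (sym (m∸[m∸n]≡n (≤-pred (∈-upTo⁻ i∈))))
                               (trans (cong (n ∸_) eq) (m∸[m∸n]≡n (≤-pred (∈-upTo⁻ j∈))))

⨁-upTo-extend : ∀ {i n} (F : ℕ → Bool) → i ≤ n →
                ⨁ (upTo (suc i)) F ≡ ⨁[ j ∈ upTo (suc n) ] ((j ≤ᵇ i) ∧ F j)
⨁-upTo-extend {i} {n} F i≤n = trans
  (⨁-cong {xs = upTo (suc i)} (λ j∈ → sym (cong (_∧ _) (T⇒≡true (≤⇒≤ᵇ (≤-pred (∈-upTo⁻ j∈)))))))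
  (sym (⨁-support _≟_ (upTo⁺ _) (upTo⁺ _)
    (λ {j} _ hj → ∈-upTo⁺ (s≤s (≤ᵇ⇒≤ j i (proj₁ (T-∧⁻ (j ≤ᵇ i) hj)))))
    (λ j∈ _ → ∈-upTo⁺ (s≤s (≤-trans (≤-pred (∈-upTo⁻ j∈)) i≤n)))))

⨁-upTo-shift : ∀ {j n} (G : ℕ → Bool) → j ≤ n →
               ⨁[ i ∈ upTo (suc n) ] ((j ≤ᵇ i) ∧ G i) ≡ ⨁[ k ∈ upTo (suc (n ∸ j)) ] G (j + k)
⨁-upTo-shift {j} {n} G j≤n = sym (trans
  (⨁-cong {xs = upTo (suc (n ∸ j))} (λ {k} _ → sym (cong (_∧ G (j + k)) (T⇒≡true (≤⇒≤ᵇ (m≤m+n j k))))))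
  (⨁-reindex _≟_ (λ k → j + k) (upTo⁺ _) (upTo⁺ _) (λ _ _ → +-cancelˡ-≡ j _ _)
    (λ k∈ _ → ∈-upTo⁺ (s≤s (subst (j + _ ≤_) (m+[n∸m]≡n j≤n) (+-monoʳ-≤ j (≤-pred (∈-upTo⁻ k∈))))))
    (λ {i} i∈ hi → let j≤i = ≤ᵇ⇒≤ j i (proj₁ (T-∧⁻ (j ≤ᵇ i) hi)) in
      i ∸ j , ∈-upTo⁺ (s≤s (∸-monoˡ-≤ j (≤-pred (∈-upTo⁻ i∈)))) , m+[n∸m]≡n {j} j≤i)))

-- The terms below and above the middle of a palindromic sum cancel in pairs.
⨁-palindrome : ∀ N (H : ℕ → Bool) → (∀ {i} → i ≤ N → H (N ∸ i) ≡ H i) →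
               ⨁ (upTo (suc N)) H ≡ ⨁[ i ∈ upTo (suc N) ] (H i ∧ (i ≡ᵇ N ∸ i))
⨁-palindrome N H symmetric = begin
  ⨁ R H                    ≡⟨ ⨁-cong split ⟩
  ⨁[ i ∈ R ] (below i xor (middle i xor above i))  ≡⟨ ⨁-xor R below _ ⟩
  ⨁ R below xor ⨁[ i ∈ R ] (middle i xor above i)  ≡⟨ cong (⨁ R below xor_) (⨁-xor R middle above) ⟩
  ⨁ R below xor (⨁ R middle xor ⨁ R above)         ≡⟨ cong (λ b → ⨁ R below xor (⨁ R middle xor b)) above≡below ⟩
  ⨁ R below xor (⨁ R middle xor ⨁ R below)         ≡⟨ cancel (⨁ R below) (⨁ R middle) ⟩
  ⨁ R middle                                       ∎
  where
  open ≡-Reasoning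
  R : List ℕ
  R = upTo (suc N)
  below middle above : ℕ → Bool
  below  i = H i ∧ (i <ᵇ N ∸ i)
  middle i = H i ∧ (i ≡ᵇ N ∸ i)
  above  i = H i ∧ (N ∸ i <ᵇ i)

  split : ∀ {i} → i ∈ R → H i ≡ below i xor (middle i xor above i)
  split {i} _ = begin
    H i                                                     ≡⟨ ∧-identityʳ (H i) ⟨
    H i ∧ true                                              ≡⟨ cong (H i ∧_) (trichotomyᵇ i (N ∸ i)) ⟨
    H i ∧ ((i <ᵇ N ∸ i) xor ((i ≡ᵇ N ∸ i) xor (N ∸ i <ᵇ i))) ≡⟨ ∧-distribˡ-xor (H i) _ _ ⟩
    below i xor (H i ∧ ((i ≡ᵇ N ∸ i) xor (N ∸ i <ᵇ i)))      ≡⟨ cong (below i xor_) (∧-distribˡ-xor (H i) _ _) ⟩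
    below i xor (middle i xor above i)                      ∎

  above≡below : ⨁ R above ≡ ⨁ R below
  above≡below = trans (sym (⨁-upTo-reflect N above)) (⨁-cong reflected)
    where
    reflected : ∀ {i} → i ∈ R → above (N ∸ i) ≡ below i
    reflected {i} i∈R = let i≤N = ≤-pred (∈-upTo⁻ i∈R) in
      cong₂ (λ b c → b ∧ (c <ᵇ N ∸ i)) (symmetric i≤N) (m∸[m∸n]≡n i≤N)

  cancel : ∀ a b → a xor (b xor a) ≡ b
  cancel a b = trans (cong (a xor_) (xor-comm b a)) (trans (sym (xor-assoc a a b)) (cong (_xor b) (xor-same a)))

⨁-indicator-convolution : ∀ N a b p q →
  ⨁[ i ∈ upTo (suc N) ] ((p ∧ (a ≡ᵇ i)) ∧ (q ∧ (b ≡ᵇ N ∸ i))) ≡ (p ∧ q) ∧ (a + b ≡ᵇ N)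
⨁-indicator-convolution N a b p q with a ≤? N
... | yes a≤N = trans (⨁-single a (upTo⁺ _) (λ _ → ∈-upTo⁺ (s≤s a≤N)) only-a) (begin
  (p ∧ (a ≡ᵇ a)) ∧ (q ∧ (b ≡ᵇ N ∸ a)) ≡⟨ cong₂ (λ x y → (p ∧ x) ∧ (q ∧ y)) (T⇒≡true (≡⇒≡ᵇ a a refl)) (≡ᵇ-∸ b a≤N) ⟩
  (p ∧ true) ∧ (q ∧ (a + b ≡ᵇ N))     ≡⟨ cong (_∧ (q ∧ (a + b ≡ᵇ N))) (∧-identityʳ p) ⟩
  p ∧ (q ∧ (a + b ≡ᵇ N))              ≡⟨ ∧-assoc p q _ ⟨
  (p ∧ q) ∧ (a + b ≡ᵇ N)              ∎)
  where
  open ≡-Reasoning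
  only-a : ∀ {i} → i ∈ upTo (suc N) → T ((p ∧ (a ≡ᵇ i)) ∧ (q ∧ (b ≡ᵇ N ∸ i))) → i ≡ a
  only-a {i} _ t = sym (≡ᵇ⇒≡ a i (proj₂ (T-∧⁻ p (proj₁ (T-∧⁻ (p ∧ (a ≡ᵇ i)) t)))))
... | no a≰N = trans (⨁-false out-of-range) (sym (trans (cong ((p ∧ q) ∧_) (¬T⇒≡false (a≰N ∘ a+b≡N⇒a≤N))) (∧-zeroʳ (p ∧ q))))
  where
  out-of-range : ∀ {i} → i ∈ upTo (suc N) → ¬ T ((p ∧ (a ≡ᵇ i)) ∧ (q ∧ (b ≡ᵇ N ∸ i)))
  out-of-range {i} i∈ t = a≰N (subst (_≤ N) (sym (≡ᵇ⇒≡ a i (proj₂ (T-∧⁻ p (proj₁ (T-∧⁻ (p ∧ (a ≡ᵇ i)) t)))))) (≤-pred (∈-upTo⁻ i∈)))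
  a+b≡N⇒a≤N : T (a + b ≡ᵇ N) → a ≤ N
  a+b≡N⇒a≤N t = subst (a ≤_) (≡ᵇ⇒≡ _ N t) (m≤m+n a b)

-- Power series over 𝔽₂

⊛-⨁ : ∀ f g n → (f ⊛ g) n ≡ ⨁[ i ∈ upTo (suc n) ] (f i ∧ g (n ∸ i))
⊛-⨁ f g n = ⨁-xorSum (upTo (suc n)) _

infix 4 _≈_

_≈_ : PS → PS → Set
f ≈ g = ∀ n → f n ≡ g n

≈-refl : ∀ {f} → f ≈ f
≈-refl n = refl

⊛-cong : ∀ {f f′ g g′} → f ≈ f′ → g ≈ g′ → f ⊛ g ≈ f′ ⊛ g′
⊛-cong {f} {f′} {g} {g′} f≈f′ g≈g′ n = begin
  (f ⊛ g) n                            ≡⟨ ⊛-⨁ f g n ⟩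
  ⨁[ i ∈ upTo (suc n) ] (f i ∧ g (n ∸ i))   ≡⟨ ⨁-cong (λ {i} _ → cong₂ _∧_ (f≈f′ i) (g≈g′ (n ∸ i))) ⟩
  ⨁[ i ∈ upTo (suc n) ] (f′ i ∧ g′ (n ∸ i)) ≡⟨ ⊛-⨁ f′ g′ n ⟨
  (f′ ⊛ g′) n                          ∎
  where open ≡-Reasoning

⊛-comm : ∀ f g → f ⊛ g ≈ g ⊛ f
⊛-comm f g n = begin
  (f ⊛ g) n                                   ≡⟨ ⊛-⨁ f g n ⟩
  ⨁[ i ∈ upTo (suc n) ] (f i ∧ g (n ∸ i))             ≡⟨ ⨁-upTo-reflect n (λ i → f i ∧ g (n ∸ i)) ⟨
  ⨁[ i ∈ upTo (suc n) ] (f (n ∸ i) ∧ g (n ∸ (n ∸ i))) ≡⟨ ⨁-cong reflected ⟩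
  ⨁[ i ∈ upTo (suc n) ] (g i ∧ f (n ∸ i))             ≡⟨ ⊛-⨁ g f n ⟨
  (g ⊛ f) n                                   ∎
  where
  open ≡-Reasoning
  reflected : ∀ {i} → i ∈ upTo (suc n) → f (n ∸ i) ∧ g (n ∸ (n ∸ i)) ≡ g i ∧ f (n ∸ i)
  reflected {i} i∈ = trans (cong (λ j → f (n ∸ i) ∧ g j) (m∸[m∸n]≡n (≤-pred (∈-upTo⁻ i∈)))) (∧-comm (f (n ∸ i)) (g i))

⊛-identityˡ : ∀ f → onePS ⊛ f ≈ f
⊛-identityˡ f n = trans (⊛-⨁ onePS f n) (⨁-single 0 (upTo⁺ _) (λ _ → ∈-upTo⁺ (s≤s z≤n)) at-0)
  where
  at-0 : ∀ {i} → i ∈ upTo (suc n) → T (onePS i ∧ f (n ∸ i)) → i ≡ 0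
  at-0 {zero} _ _ = refl

⊛-assoc : ∀ f g h → (f ⊛ g) ⊛ h ≈ f ⊛ (g ⊛ h)
⊛-assoc f g h n = begin
  ((f ⊛ g) ⊛ h) n                                                    ≡⟨ ⊛-⨁ (f ⊛ g) h n ⟩
  ⨁[ i ∈ R n ] ((f ⊛ g) i ∧ h (n ∸ i))                               ≡⟨ ⨁-cong expand ⟩
  ⨁[ i ∈ R n ] ⨁[ j ∈ R n ] ((j ≤ᵇ i) ∧ (f j ∧ (g (i ∸ j) ∧ h (n ∸ i)))) ≡⟨ ⨁-comm (R n) (R n) _ ⟩
  ⨁[ j ∈ R n ] ⨁[ i ∈ R n ] ((j ≤ᵇ i) ∧ (f j ∧ (g (i ∸ j) ∧ h (n ∸ i)))) ≡⟨ ⨁-cong contract ⟩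
  ⨁[ j ∈ R n ] (f j ∧ (g ⊛ h) (n ∸ j))                               ≡⟨ ⊛-⨁ f (g ⊛ h) n ⟨
  (f ⊛ (g ⊛ h)) n                                                    ∎
  where
  open ≡-Reasoning
  R : ℕ → List ℕ
  R n = upTo (suc n)

  expand : ∀ {i} → i ∈ R n → (f ⊛ g) i ∧ h (n ∸ i) ≡ ⨁[ j ∈ R n ] ((j ≤ᵇ i) ∧ (f j ∧ (g (i ∸ j) ∧ h (n ∸ i))))
  expand {i} i∈ = begin
    (f ⊛ g) i ∧ h (n ∸ i)                                   ≡⟨ cong (_∧ h (n ∸ i)) (⊛-⨁ f g i) ⟩
    ⨁[ j ∈ R i ] (f j ∧ g (i ∸ j)) ∧ h (n ∸ i)              ≡⟨ cong (_∧ h (n ∸ i)) (⨁-upTo-extend _ (≤-pred (∈-upTo⁻ i∈))) ⟩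
    ⨁[ j ∈ R n ] ((j ≤ᵇ i) ∧ (f j ∧ g (i ∸ j))) ∧ h (n ∸ i)  ≡⟨ ⨁-∧ʳ (R n) (h (n ∸ i)) _ ⟨
    ⨁[ j ∈ R n ] (((j ≤ᵇ i) ∧ (f j ∧ g (i ∸ j))) ∧ h (n ∸ i)) ≡⟨ ⨁-cong (λ {j} _ → ∧-assoc (j ≤ᵇ i) _ _) ⟩
    ⨁[ j ∈ R n ] ((j ≤ᵇ i) ∧ ((f j ∧ g (i ∸ j)) ∧ h (n ∸ i))) ≡⟨ ⨁-cong (λ {j} _ → cong ((j ≤ᵇ i) ∧_) (∧-assoc (f j) _ _)) ⟩
    ⨁[ j ∈ R n ] ((j ≤ᵇ i) ∧ (f j ∧ (g (i ∸ j) ∧ h (n ∸ i)))) ∎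

  contract : ∀ {j} → j ∈ R n → ⨁[ i ∈ R n ] ((j ≤ᵇ i) ∧ (f j ∧ (g (i ∸ j) ∧ h (n ∸ i)))) ≡ f j ∧ (g ⊛ h) (n ∸ j)
  contract {j} j∈ = begin
    ⨁[ i ∈ R n ] ((j ≤ᵇ i) ∧ (f j ∧ (g (i ∸ j) ∧ h (n ∸ i)))) ≡⟨ ⨁-cong (λ {i} _ → ∧-swap (j ≤ᵇ i) (f j) _) ⟩
    ⨁[ i ∈ R n ] (f j ∧ ((j ≤ᵇ i) ∧ (g (i ∸ j) ∧ h (n ∸ i)))) ≡⟨ ⨁-∧ˡ (R n) (f j) _ ⟩
    f j ∧ ⨁[ i ∈ R n ] ((j ≤ᵇ i) ∧ (g (i ∸ j) ∧ h (n ∸ i)))   ≡⟨ cong (f j ∧_) (⨁-upTo-shift _ (≤-pred (∈-upTo⁻ j∈))) ⟩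
    f j ∧ ⨁[ k ∈ R (n ∸ j) ] (g ((j + k) ∸ j) ∧ h (n ∸ (j + k))) ≡⟨ cong (f j ∧_) (⨁-cong (λ {k} _ → cong₂ (λ a b → g a ∧ h b)
                                                                   (m+n∸m≡n j k) (sym (∸-+-assoc n j k)))) ⟩
    f j ∧ ⨁[ k ∈ R (n ∸ j) ] (g k ∧ h ((n ∸ j) ∸ k))          ≡⟨ cong (f j ∧_) (⊛-⨁ g h (n ∸ j)) ⟨
    f j ∧ (g ⊛ h) (n ∸ j)                                     ∎
    where
    ∧-swap : ∀ a b c → a ∧ (b ∧ c) ≡ b ∧ (a ∧ c)
    ∧-swap a b c = trans (sym (∧-assoc a b c)) (trans (cong (_∧ c) (∧-comm a b)) (∧-assoc b a c))

⊛-commutativeMonoid : CommutativeMonoid 0ℓ 0ℓ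
⊛-commutativeMonoid = record
  { Carrier = PS ; _≈_ = _≈_ ; _∙_ = _⊛_ ; ε = onePS
  ; isCommutativeMonoid = record
    { isMonoid = record
      { isSemigroup = record
        { isMagma = record
          { isEquivalence = record { refl = ≈-refl ; sym = λ p n → sym (p n) ; trans = λ p q n → trans (p n) (q n) }
          ; ∙-cong = ⊛-cong }
        ; assoc = ⊛-assoc }
      ; identity = ⊛-identityˡ , λ f n → trans (⊛-comm f onePS n) (⊛-identityˡ f n) }
    ; comm = ⊛-comm } }

open import Algebra.Solver.CommutativeMonoid ⊛-commutativeMonoid using (solve; _⊜_; _⊕_; Expr) renaming (id to 𝟙)

_⊕^_ : ∀ {n} → Expr n → ℕ → Expr n
e ⊕^ zero  = 𝟙
e ⊕^ suc k = e ⊕ (e ⊕^ k)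

^ᵖ-cong : ∀ {f g} k → f ≈ g → f ^ᵖ k ≈ g ^ᵖ k
^ᵖ-cong zero    f≈g n = refl
^ᵖ-cong (suc k) f≈g   = ⊛-cong f≈g (^ᵖ-cong k f≈g)

X^-⊛-≥ : ∀ {a k} g → a ≤ k → (X^ a ⊛ g) k ≡ g (k ∸ a)
X^-⊛-≥ {a} {k} g a≤k = trans (⊛-⨁ (X^ a) g k)
  (trans (⨁-single a (upTo⁺ _) (λ _ → ∈-upTo⁺ (s≤s a≤k)) (λ {i} _ hi → ≡ᵇ⇒≡ i a (proj₁ (T-∧⁻ (i ≡ᵇ a) hi))))
         (cong (_∧ g (k ∸ a)) (T⇒≡true (≡⇒≡ᵇ a a refl))))

X^-⊛-< : ∀ {a k} g → k < a → (X^ a ⊛ g) k ≡ false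
X^-⊛-< {a} {k} g k<a = trans (⊛-⨁ (X^ a) g k)
  (⨁-false λ {i} i∈ hi → <⇒≢ (≤-<-trans (≤-pred (∈-upTo⁻ i∈)) k<a) (≡ᵇ⇒≡ i a (proj₁ (T-∧⁻ (i ≡ᵇ a) hi))))

⊛-sparse : ∀ {I J : Set} (xs : List I) (ys : List J) (P : I → Bool) (Q : J → Bool) (a : I → ℕ) (b : J → ℕ)
  {f g : PS} N →
  (∀ {k} → k ≤ N → f k ≡ ⨁[ s ∈ xs ] (P s ∧ (a s ≡ᵇ k))) →
  (∀ {k} → k ≤ N → g k ≡ ⨁[ t ∈ ys ] (Q t ∧ (b t ≡ᵇ k))) →
  (f ⊛ g) N ≡ ⨁ (cartesianProduct xs ys) (uncurry λ s t → (P s ∧ Q t) ∧ (a s + b t ≡ᵇ N))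
⊛-sparse {I} {J} xs ys P Q a b {f} {g} N f≡ g≡ = begin
  (f ⊛ g) N
    ≡⟨ ⊛-⨁ f g N ⟩
  ⨁[ i ∈ R ] (f i ∧ g (N ∸ i))
    ≡⟨ ⨁-cong (λ {i} i∈ → cong₂ _∧_ (f≡ (≤-pred (∈-upTo⁻ i∈))) (g≡ (m∸n≤m N i))) ⟩
  ⨁[ i ∈ R ] (⨁[ s ∈ xs ] (P s ∧ (a s ≡ᵇ i)) ∧ ⨁[ t ∈ ys ] (Q t ∧ (b t ≡ᵇ N ∸ i)))
    ≡⟨ ⨁-cong (λ {i} _ → ⨁-∧-⨁ xs ys (λ s → P s ∧ (a s ≡ᵇ i)) (λ t → Q t ∧ (b t ≡ᵇ N ∸ i))) ⟩
  ⨁[ i ∈ R ] ⨁[ s ∈ xs ] ⨁[ t ∈ ys ] term i s t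
    ≡⟨ ⨁-comm R xs (λ i s → ⨁[ t ∈ ys ] term i s t) ⟩
  ⨁[ s ∈ xs ] ⨁[ i ∈ R ] ⨁[ t ∈ ys ] term i s t
    ≡⟨ ⨁-cong (λ {s} _ → ⨁-comm R ys (λ i t → term i s t)) ⟩
  ⨁[ s ∈ xs ] ⨁[ t ∈ ys ] ⨁[ i ∈ R ] term i s t
    ≡⟨ ⨁-cong (λ {s} _ → ⨁-cong (λ {t} _ → ⨁-indicator-convolution N (a s) (b t) (P s) (Q t))) ⟩
  ⨁[ s ∈ xs ] ⨁[ t ∈ ys ] ((P s ∧ Q t) ∧ (a s + b t ≡ᵇ N))
    ≡⟨ ⨁-cartesianProduct xs ys _ ⟨
  ⨁ (cartesianProduct xs ys) (uncurry λ s t → (P s ∧ Q t) ∧ (a s + b t ≡ᵇ N)) ∎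
  where
  open ≡-Reasoning
  R : List ℕ
  R = upTo (suc N)
  term : ℕ → I → J → Bool
  term i s t = (P s ∧ (a s ≡ᵇ i)) ∧ (Q t ∧ (b t ≡ᵇ N ∸ i))

sq : PS → PS
sq g = g ⊛ g

sq-⨁ : ∀ g N → sq g N ≡ ⨁[ i ∈ upTo (suc N) ] ((g i ∧ g (N ∸ i)) ∧ (i ≡ᵇ N ∸ i))
sq-⨁ g N = trans (⊛-⨁ g g N) (⨁-palindrome N (λ i → g i ∧ g (N ∸ i)) symmetric)
  where
  symmetric : ∀ {i} → i ≤ N → g (N ∸ i) ∧ g (N ∸ (N ∸ i)) ≡ g i ∧ g (N ∸ i)
  symmetric {i} i≤N = trans (cong (λ j → g (N ∸ i) ∧ g j) (m∸[m∸n]≡n i≤N)) (∧-comm (g (N ∸ i)) (g i))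

sq-double : ∀ g n → sq g (n + n) ≡ g n
sq-double g n = trans (sq-⨁ g (n + n)) (trans (⨁-single n (upTo⁺ _) (λ _ → ∈-upTo⁺ (s≤s (m≤m+n n n))) only-n) at-n)
  where
  only-n : ∀ {i} → i ∈ upTo (suc (n + n)) → T ((g i ∧ g ((n + n) ∸ i)) ∧ (i ≡ᵇ (n + n) ∸ i)) → i ≡ n
  only-n {i} i∈ hi = double-injective (trans (cong (λ k → i + k) (≡ᵇ⇒≡ i _ (proj₂ (T-∧⁻ (g i ∧ g ((n + n) ∸ i)) hi))))
                                             (m+[n∸m]≡n (≤-pred (∈-upTo⁻ i∈))))
  at-n : (g n ∧ g ((n + n) ∸ n)) ∧ (n ≡ᵇ (n + n) ∸ n) ≡ g n
  at-n rewrite m+n∸n≡m n n = trans (cong₂ _∧_ (∧-idem (g n)) (T⇒≡true (≡⇒≡ᵇ n n refl))) (∧-identityʳ (g n))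

sq-odd : ∀ g n → sq g (suc (n + n)) ≡ false
sq-odd g n = trans (sq-⨁ g (suc (n + n))) (⨁-false no-middle)
  where
  no-middle : ∀ {i} → i ∈ upTo (suc (suc (n + n))) → ¬ T ((g i ∧ g (suc (n + n) ∸ i)) ∧ (i ≡ᵇ suc (n + n) ∸ i))
  no-middle {i} i∈ hi = double≢suc-double i n
    (trans (cong (λ k → i + k) (≡ᵇ⇒≡ i _ (proj₂ (T-∧⁻ (g i ∧ g (suc (n + n) ∸ i)) hi)))) (m+[n∸m]≡n (≤-pred (∈-upTo⁻ i∈))))

^ᵖ16≈sq⁴ : ∀ g → g ^ᵖ 16 ≈ sq (sq (sq (sq g)))
^ᵖ16≈sq⁴ = solve 1 (λ x → x ⊕^ 16 ⊜ square (square (square (square x)))) (λ _ → refl)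
  where
  square : ∀ {n} → Expr n → Expr n
  square x = x ⊕ x

Ev : PS → PS
Ev h n = h (n + n)

Ev-cong : ∀ {f g} → f ≈ g → Ev f ≈ Ev g
Ev-cong f≈g n = f≈g (n + n)

Ev-sq-⊛ : ∀ g h → Ev (sq g ⊛ h) ≈ g ⊛ Ev h
Ev-sq-⊛ g h n = begin
  (sq g ⊛ h) (n + n)                                        ≡⟨ ⊛-⨁ (sq g) h (n + n) ⟩
  ⨁[ i ∈ upTo (suc (n + n)) ] (sq g i ∧ h ((n + n) ∸ i))     ≡⟨ ⨁-reindex _≟_ (λ j → j + j) (upTo⁺ _) (upTo⁺ _)
                                                                   (λ _ _ → double-injective) into onto ⟨
  ⨁[ j ∈ upTo (suc n) ] (sq g (j + j) ∧ h ((n + n) ∸ (j + j))) ≡⟨ ⨁-cong (λ {j} _ → cong₂ _∧_ (sq-double g j) (cong h (double-∸ n j))) ⟩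
  ⨁[ j ∈ upTo (suc n) ] (g j ∧ Ev h (n ∸ j))                   ≡⟨ ⊛-⨁ g (Ev h) n ⟨
  (g ⊛ Ev h) n                                               ∎
  where
  open ≡-Reasoning
  into : ∀ {j} → j ∈ upTo (suc n) → T (sq g (j + j) ∧ h ((n + n) ∸ (j + j))) → j + j ∈ upTo (suc (n + n))
  into j∈ _ = ∈-upTo⁺ (s≤s (+-mono-≤ (≤-pred (∈-upTo⁻ j∈)) (≤-pred (∈-upTo⁻ j∈))))
  onto : ∀ {i} → i ∈ upTo (suc (n + n)) → T (sq g i ∧ h ((n + n) ∸ i)) → ∃[ j ] j ∈ upTo (suc n) × j + j ≡ i
  onto {i} i∈ hi with parity i
  ... | j , inj₁ refl = j , ∈-upTo⁺ (s≤s (double-≤-cancel (≤-pred (∈-upTo⁻ i∈)))) , refl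
  ... | j , inj₂ refl = contradiction (subst T (sq-odd g j) (proj₁ (T-∧⁻ (sq g (suc (j + j))) hi))) λ ()

-- Laurent coefficients

%ℕ≡0⇔∣ : ∀ e d .{{_ : ℕ.NonZero d}} → e %ℕ d ≡ 0 ⇔ + d ∣ e
%ℕ≡0⇔∣ e d = mk⇔ to (from e)
  where
  to : e %ℕ d ≡ 0 → + d ∣ e
  to e%d≡0 = divides (e /ℕ d) (trans (a≡a%ℕn+[a/ℕn]*n e d) (trans (cong (λ r → + r ℤ.+ (e /ℕ d) ℤ.* + d) e%d≡0) (ℤ.+-identityˡ _)))
  from : ∀ e → + d ∣ e → e %ℕ d ≡ 0
  from (+ n)    d∣e = n∣m⇒m%n≡0 n d (∣⇒∣ᵤ d∣e)
  from -[1+ n ] d∣e with suc n % d in eq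
  ... | zero  = refl
  ... | suc r = contradiction (trans (sym eq) (n∣m⇒m%n≡0 (suc n) d (∣⇒∣ᵤ d∣e))) λ ()

T-%ℕ≡ᵇ0⇔∣ : ∀ e d .{{_ : ℕ.NonZero d}} → T ((e %ℕ d) ≡ᵇ 0) ⇔ + d ∣ e
T-%ℕ≡ᵇ0⇔∣ e d = mk⇔ (Equivalence.to (%ℕ≡0⇔∣ e d) ∘′ ≡ᵇ⇒≡ _ 0) (≡⇒≡ᵇ _ 0 ∘′ Equivalence.from (%ℕ≡0⇔∣ e d))

psToLS-cong : ∀ {f g} → f ≈ g → ∀ e → psToLS f e ≡ psToLS g e
psToLS-cong f≈g (+ n)    = f≈g n
psToLS-cong f≈g -[1+ n ] = refl

psToLS-X^-shift : ∀ a g e → psToLS (X^ a ⊛ g) (e ℤ.+ + a) ≡ psToLS g e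
psToLS-X^-shift a g (+ n) = trans (X^-⊛-≥ g (m≤n+m a n)) (cong g (m+n∸n≡m n a))
psToLS-X^-shift a g -[1+ n ] with -[1+ n ] ℤ.+ + a in eq
... | -[1+ _ ] = refl
... | + k      = X^-⊛-< g (ℤ.drop‿+<+ (subst (ℤ._< + a) eq (ℤ.m⊖1+n<m a (suc n))))

psToLS-X^^-shift : ∀ a k g e → psToLS ((X^ a ^ᵖ k) ⊛ g) (e ℤ.+ + (k * a)) ≡ psToLS g e
psToLS-X^^-shift a zero    g e = trans (cong (psToLS (onePS ⊛ g)) (ℤ.+-identityʳ e)) (psToLS-cong (⊛-identityˡ g) e)
psToLS-X^^-shift a (suc k) g e = begin
  psToLS ((X^ a ⊛ (X^ a ^ᵖ k)) ⊛ g) (e ℤ.+ + (a + k * a))       ≡⟨ psToLS-cong (⊛-assoc (X^ a) (X^ a ^ᵖ k) g) (e ℤ.+ + (a + k * a)) ⟩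
  psToLS (X^ a ⊛ ((X^ a ^ᵖ k) ⊛ g)) (e ℤ.+ + (a + k * a))       ≡⟨ cong (psToLS (X^ a ⊛ ((X^ a ^ᵖ k) ⊛ g))) reassociate ⟩
  psToLS (X^ a ⊛ ((X^ a ^ᵖ k) ⊛ g)) ((e ℤ.+ + (k * a)) ℤ.+ + a) ≡⟨ psToLS-X^-shift a ((X^ a ^ᵖ k) ⊛ g) (e ℤ.+ + (k * a)) ⟩
  psToLS ((X^ a ^ᵖ k) ⊛ g) (e ℤ.+ + (k * a))                    ≡⟨ psToLS-X^^-shift a k g e ⟩
  psToLS g e                                                  ∎
  where
  open ≡-Reasoning
  reassociate : e ℤ.+ + (a + k * a) ≡ (e ℤ.+ + (k * a)) ℤ.+ + a
  reassociate = trans (cong (λ x → e ℤ.+ x) (ℤ.pos-+ a (k * a))) (+-rotate e (+ a) (+ (k * a)))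
    where
    +-rotate : ∀ x y z → x ℤ.+ (y ℤ.+ z) ≡ (x ℤ.+ z) ℤ.+ y
    +-rotate = solve-∀

psToLS-Ev : ∀ g e → psToLS (Ev g) e ≡ psToLS g (e ℤ.+ e)
psToLS-Ev g (+ n)    = refl
psToLS-Ev g -[1+ n ] = refl

psToLS-sq-double : ∀ g e → psToLS (sq g) (e ℤ.+ e) ≡ psToLS g e
psToLS-sq-double g (+ n)    = sq-double g n
psToLS-sq-double g -[1+ n ] = refl

psToLS-sq-support : ∀ g e → T (psToLS (sq g) e) → ∃[ d ] e ≡ d ℤ.+ d × T (psToLS g d)
psToLS-sq-support g (+ n) sq[g]ₑ with parity n
... | k , inj₁ refl = + k , refl , subst T (sq-double g k) sq[g]ₑ
... | k , inj₂ refl = contradiction (subst T (sq-odd g k) sq[g]ₑ) λ ()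

octuple : ℤ → ℤ
octuple d = ((d ℤ.+ d) ℤ.+ (d ℤ.+ d)) ℤ.+ ((d ℤ.+ d) ℤ.+ (d ℤ.+ d))

8∣⇔octuple : ∀ e → + 8 ∣ e ⇔ (∃[ d ] e ≡ octuple d)
8∣⇔octuple e = mk⇔ (λ { (divides d e≡d*8) → d , trans e≡d*8 (*8≡octuple d) })
                   (λ { (d , e≡) → divides d (trans e≡ (sym (*8≡octuple d))) })
  where
  *8≡octuple : ∀ d → d ℤ.* + 8 ≡ ((d ℤ.+ d) ℤ.+ (d ℤ.+ d)) ℤ.+ ((d ℤ.+ d) ℤ.+ (d ℤ.+ d))
  *8≡octuple = solve-∀

psToLS-Ev³ : ∀ g d → psToLS (Ev (Ev (Ev g))) d ≡ psToLS g (octuple d)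
psToLS-Ev³ g d = trans (psToLS-Ev (Ev (Ev g)) d) (trans (psToLS-Ev (Ev g) (d ℤ.+ d)) (psToLS-Ev g ((d ℤ.+ d) ℤ.+ (d ℤ.+ d))))

psToLS-sq³-octuple : ∀ g d → psToLS (sq (sq (sq g))) (octuple d) ≡ psToLS g d
psToLS-sq³-octuple g d = trans (psToLS-sq-double (sq (sq g)) ((d ℤ.+ d) ℤ.+ (d ℤ.+ d)))
                        (trans (psToLS-sq-double (sq g) (d ℤ.+ d)) (psToLS-sq-double g d))

psToLS-sq³-support : ∀ g e → T (psToLS (sq (sq (sq g))) e) → ∃[ d ] e ≡ octuple d
psToLS-sq³-support g e sq³[g]ₑ with psToLS-sq-support (sq (sq g)) e sq³[g]ₑ
... | d₁ , refl , sq²[g]ₑ with psToLS-sq-support (sq g) d₁ sq²[g]ₑ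
...   | d₂ , refl , sq[g]ₑ with psToLS-sq-support g d₂ sq[g]ₑ
...     | d , refl , _ = d , refl

module Reciprocal (A B f : PS) (m : ℕ)
  (Af≈xᵐ : A ⊛ f ≈ X^ m) (Ev-A : Ev A ≈ sq B) (Ev-AB : Ev (A ⊛ B) ≈ A ⊛ B) where

  Ev-sq-⊛-A : ∀ Q → Ev (sq Q ⊛ A) ≈ Q ⊛ sq B
  Ev-sq-⊛-A Q n = trans (Ev-sq-⊛ Q A n) (⊛-cong (≈-refl {Q}) Ev-A n)

  Ev³[x⁷ᵐf]≈xᵐB² : Ev (Ev (Ev ((X^ m ^ᵖ 7) ⊛ f))) ≈ X^ m ⊛ sq B
  Ev³[x⁷ᵐf]≈xᵐB² = begin
    Ev (Ev (Ev ((X^ m ^ᵖ 7) ⊛ f)))    ≈⟨ Ev-cong (Ev-cong (Ev-cong (⊛-cong (^ᵖ-cong 7 Af≈xᵐ) (≈-refl {f})))) ⟨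
    Ev (Ev (Ev (((A ⊛ f) ^ᵖ 7) ⊛ f))) ≈⟨ Ev-cong (Ev-cong (Ev-cong
                                           (solve 2 (λ a x → ((a ⊕ x) ⊕^ 7) ⊕ x ⊜ (a³x⁴ _⊕_ a x ⊕ a³x⁴ _⊕_ a x) ⊕ a) (λ _ → refl) A f))) ⟩
    Ev (Ev (Ev (sq (a³x⁴ _⊛_ A f) ⊛ A)))    ≈⟨ Ev-cong (Ev-cong (Ev-sq-⊛-A (a³x⁴ _⊛_ A f))) ⟩
    Ev (Ev (a³x⁴ _⊛_ A f ⊛ sq B))           ≈⟨ Ev-cong (Ev-cong
                                           (solve 3 (λ a x b → a³x⁴ _⊕_ a x ⊕ (b ⊕ b) ⊜ (ax²b _⊕_ a x b ⊕ ax²b _⊕_ a x b) ⊕ a) (λ _ → refl) A f B)) ⟩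
    Ev (Ev (sq (ax²b _⊛_ A f B) ⊛ A))       ≈⟨ Ev-cong (Ev-sq-⊛-A (ax²b _⊛_ A f B)) ⟩
    Ev (ax²b _⊛_ A f B ⊛ sq B)              ≈⟨ Ev-cong
                                           (solve 3 (λ a x b → ax²b _⊕_ a x b ⊕ (b ⊕ b) ⊜ ((x ⊕ b) ⊕ (x ⊕ b)) ⊕ (a ⊕ b)) (λ _ → refl) A f B) ⟩
    Ev (sq (f ⊛ B) ⊛ (A ⊛ B))         ≈⟨ Ev-sq-⊛ (f ⊛ B) (A ⊛ B) ⟩
    (f ⊛ B) ⊛ Ev (A ⊛ B)              ≈⟨ ⊛-cong (≈-refl {f ⊛ B}) Ev-AB ⟩
    (f ⊛ B) ⊛ (A ⊛ B)                 ≈⟨ solve 3 (λ a x b → (x ⊕ b) ⊕ (a ⊕ b) ⊜ (a ⊕ x) ⊕ (b ⊕ b)) (λ _ → refl) A f B ⟩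
    (A ⊛ f) ⊛ sq B                    ≈⟨ ⊛-cong Af≈xᵐ (≈-refl {sq B}) ⟩
    X^ m ⊛ sq B                       ∎
    where
    open SetoidReasoning (CommutativeMonoid.setoid ⊛-commutativeMonoid)
    a³x⁴ : {C : Set} → (C → C → C) → C → C → C
    a³x⁴ _·_ a x = a · (a · (a · (x · (x · (x · x)))))
    ax²b : {C : Set} → (C → C → C) → C → C → C → C
    ax²b _·_ a x b = a · (x · (x · b))

  coefficient-octuple : ∀ q → psToLS f (octuple q ℤ.+ + m) ≡ psToLS (sq B) q
  coefficient-octuple q = begin
    psToLS f (octuple q ℤ.+ + m)                                 ≡⟨ psToLS-X^^-shift m 7 f (octuple q ℤ.+ + m) ⟨
    psToLS ((X^ m ^ᵖ 7) ⊛ f) ((octuple q ℤ.+ + m) ℤ.+ + (7 * m)) ≡⟨ cong (psToLS ((X^ m ^ᵖ 7) ⊛ f)) regroup ⟩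
    psToLS ((X^ m ^ᵖ 7) ⊛ f) (octuple (q ℤ.+ + m))               ≡⟨ psToLS-Ev³ ((X^ m ^ᵖ 7) ⊛ f) (q ℤ.+ + m) ⟨
    psToLS (Ev (Ev (Ev ((X^ m ^ᵖ 7) ⊛ f)))) (q ℤ.+ + m)          ≡⟨ psToLS-cong Ev³[x⁷ᵐf]≈xᵐB² (q ℤ.+ + m) ⟩
    psToLS (X^ m ⊛ sq B) (q ℤ.+ + m)                             ≡⟨ psToLS-X^-shift m (sq B) q ⟩
    psToLS (sq B) q                                              ∎
    where
    open ≡-Reasoning
    regroup : (octuple q ℤ.+ + m) ℤ.+ + (7 * m) ≡ octuple (q ℤ.+ + m)
    regroup = trans (cong (λ x → (octuple q ℤ.+ + m) ℤ.+ x) (ℤ.pos-* 7 m)) (ring q (+ m))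
      where
      ring : ∀ q m → (((((q ℤ.+ q) ℤ.+ (q ℤ.+ q)) ℤ.+ ((q ℤ.+ q) ℤ.+ (q ℤ.+ q))) ℤ.+ m) ℤ.+ + 7 ℤ.* m) ≡
             (((q ℤ.+ m) ℤ.+ (q ℤ.+ m)) ℤ.+ ((q ℤ.+ m) ℤ.+ (q ℤ.+ m))) ℤ.+ (((q ℤ.+ m) ℤ.+ (q ℤ.+ m)) ℤ.+ ((q ℤ.+ m) ℤ.+ (q ℤ.+ m)))
      ring = solve-∀

  proj-reciprocal : ∀ e → proj 8 0 (shiftLS m f) e ≡ psToLS (sq (sq (sq (sq B)))) e
  proj-reciprocal e with (e %ℕ 8) ≡ᵇ 0 in guard
  ... | true with Equivalence.to (8∣⇔octuple e) (Equivalence.to (T-%ℕ≡ᵇ0⇔∣ e 8) (subst T (sym guard) _))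
  ...   | q , refl = trans (coefficient-octuple q) (sym (psToLS-sq³-octuple (sq B) q))
  proj-reciprocal e | false = sym (¬T⇒≡false λ sq⁴[B]ₑ →
    subst T guard (Equivalence.from (T-%ℕ≡ᵇ0⇔∣ e 8) (Equivalence.from (8∣⇔octuple e) (psToLS-sq³-support (sq B) e sq⁴[B]ₑ))))

-- The theta series [i]

‖_‖ : ℤ → ℕ
‖ n ‖ = ∣ n ∣ ℕ.* ∣ n ∣

+‖‖ : ∀ n → + ‖ n ‖ ≡ n ℤ.* n
+‖‖ (+ n)    = ℤ.pos-* n n
+‖‖ -[1+ n ] = refl

∣∣≤‖‖ : ∀ n → ∣ n ∣ ≤ ‖ n ‖
∣∣≤‖‖ n with ∣ n ∣
... | zero  = z≤n
... | suc k = m≤m*n (suc k) (suc k)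

ℤrange : ℕ → List ℤ
ℤrange k = map (λ j → + j ℤ.- + k) (upTo (suc (2 * k)))

ℤrange-unique : ∀ k → Unique (ℤrange k)
ℤrange-unique k = map⁺ (λ {i} {j} eq → ℤ.+-injective (trans (sym (-+ (+ i) (+ k))) (trans (cong (ℤ._+ + k) eq) (-+ (+ j) (+ k)))))
                       (upTo⁺ _)
  where
  -+ : ∀ x y → (x ℤ.- y) ℤ.+ y ≡ x
  -+ = solve-∀

∈-ℤrange : ∀ {n k} → ‖ n ‖ ≤ k → n ∈ ℤrange k
∈-ℤrange {n} {k} ‖n‖≤k = at n (≤-trans (∣∣≤‖‖ n) ‖n‖≤k)
  where
  at-index : ∀ {n} j → j ≤ 2 * k → + j ℤ.- + k ≡ n → n ∈ ℤrange k
  at-index j j≤2k refl = ∈-map⁺ (λ j → + j ℤ.- + k) (∈-upTo⁺ (s≤s j≤2k))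
  +-- : ∀ x y → (x ℤ.+ y) ℤ.- y ≡ x
  +-- = solve-∀
  at : ∀ n → ∣ n ∣ ≤ k → n ∈ ℤrange k
  at (+ a)    a≤k  = at-index (a + k) (≤-trans (+-monoˡ-≤ k a≤k) (≤-reflexive (cong (λ x → k + x) (sym (+-identityʳ k)))))
                       (trans (cong (ℤ._- + k) (ℤ.pos-+ a k)) (+-- (+ a) (+ k)))
  at -[1+ a ] a<k = at-index (k ∸ suc a) (≤-trans (m∸n≤m k (suc a)) (m≤n*m k 2))
                       (trans (cong (ℤ._- + k) (sym (ℤ.⊖-≥ a<k))) (trans (cong (ℤ._- + k) (ℤ.+-comm -[1+ a ] (+ k))) (+-- -[1+ a ] (+ k))))

infix 4 _≡₅_

_≡₅_ : ℤ → ℤ → Bool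
n ≡₅ i = (n ℤ.- i) %ℕ 5 ≡ᵇ 0

T-≡₅ : ∀ x i → T (x ≡₅ i) ⇔ + 5 ∣ (x ℤ.- i)
T-≡₅ x i = T-%ℕ≡ᵇ0⇔∣ (x ℤ.- i) 5

T-≡₅-∧ : ∀ x y i j → T ((x ≡₅ i) ∧ (y ≡₅ j)) ⇔ ((+ 5 ∣ (x ℤ.- i)) × (+ 5 ∣ (y ℤ.- j)))
T-≡₅-∧ x y i j = mk⇔
  (λ h → let hx , hy = T-∧⁻ (x ≡₅ i) h in to (T-≡₅ x i) hx , to (T-≡₅ y j) hy)
  (λ { (5∣x , 5∣y) → from (T-∧ {x ≡₅ i}) (from (T-≡₅ x i) 5∣x , from (T-≡₅ y j) 5∣y) })
  where open Equivalence

θ-term : ℤ → ℕ → ℤ → Bool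
θ-term i k n = (n ≡₅ i) ∧ (‖ n ‖ ≡ᵇ k)

theta-⨁ : ∀ i k → theta i k ≡ ⨁ (ℤrange k) (θ-term i k)
theta-⨁ i k = trans (⨁-xorSum (upTo (suc (2 * k))) _) (sym (⨁-map (λ j → + j ℤ.- + k) (upTo (suc (2 * k))) (θ-term i k)))

T-θ-term⇒‖‖ : ∀ i k n → T (θ-term i k n) → ‖ n ‖ ≡ k
T-θ-term⇒‖‖ i k n t = ≡ᵇ⇒≡ _ k (proj₂ (T-∧⁻ (n ≡₅ i) t))

theta-⨁-extend : ∀ i {k N} → k ≤ N → theta i k ≡ ⨁ (ℤrange N) (θ-term i k)
theta-⨁-extend i {k} {N} k≤N = trans (theta-⨁ i k) (sym (⨁-support ℤ._≟_ (ℤrange-unique k) (ℤrange-unique N)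
  (λ {n} _ t → ∈-ℤrange (≤-reflexive (T-θ-term⇒‖‖ i k n t)))
  (λ {n} _ t → ∈-ℤrange (≤-trans (≤-reflexive (T-θ-term⇒‖‖ i k n t)) k≤N))))

%ℕ≡ᵇ0-cong : ∀ {x y} d .{{_ : ℕ.NonZero d}} → (+ d ∣ x) ⇔ (+ d ∣ y) → (x %ℕ d ≡ᵇ 0) ≡ (y %ℕ d ≡ᵇ 0)
%ℕ≡ᵇ0-cong {x} {y} d x⇔y = T⇔T⇒≡ (mk⇔ (from (T-%ℕ≡ᵇ0⇔∣ y d) ∘ to x⇔y ∘ to (T-%ℕ≡ᵇ0⇔∣ x d))
                                      (from (T-%ℕ≡ᵇ0⇔∣ x d) ∘ from x⇔y ∘ to (T-%ℕ≡ᵇ0⇔∣ y d)))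
  where open Equivalence

∣-combination : ∀ {k x y w} a b c → x ≡ a ℤ.* y ℤ.+ b ℤ.* w ℤ.+ c ℤ.* k → k ∣ y → k ∣ w → k ∣ x
∣-combination a b c refl k∣y k∣w = ∣m∣n⇒∣m+n (∣m∣n⇒∣m+n (∣n⇒∣m*n a k∣y) (∣n⇒∣m*n b k∣w)) (∣n⇒∣m*n c ∣-refl)

2∣²⇒2∣ : ∀ x → + 2 ∣ x ℤ.* x → + 2 ∣ x
2∣²⇒2∣ x 2∣x² with euclidsLemma ∣ x ∣ ∣ x ∣ prime[2] (subst (2 ∣ℕ_) (ℤ.abs-* x x) (∣⇒∣ᵤ 2∣x²))
... | inj₁ 2∣∣x∣ = ∣ᵤ⇒∣ 2∣∣x∣
... | inj₂ 2∣∣x∣ = ∣ᵤ⇒∣ 2∣∣x∣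

2∣-double : ∀ j → + 2 ∣ + (j + j)
2∣-double j = divides (+ j) (trans (ℤ.pos-+ j j) (twice (+ j)))
  where
  twice : ∀ x → x ℤ.+ x ≡ x ℤ.* + 2
  twice = solve-∀

‖‖≢4j+2 : ∀ n j → ‖ n ‖ ≢ suc (j + j) + suc (j + j)
‖‖≢4j+2 n j ‖n‖≡ with parity ∣ n ∣
... | k , inj₁ ∣n∣≡ = double≢suc-double (k ℕ.* k) j
                        (double-injective (trans (sym (even² k)) (trans (cong (λ a → a ℕ.* a) (sym ∣n∣≡)) ‖n‖≡)))
  where
  even² : ∀ k → (k + k) ℕ.* (k + k) ≡ (k ℕ.* k + k ℕ.* k) + (k ℕ.* k + k ℕ.* k)
  even² = ℕ-Solver.solve-∀
... | k , inj₂ ∣n∣≡ = double≢suc-double (suc (j + j)) (k ℕ.* k + k ℕ.* k + k + k)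
                        (sym (trans (sym (odd² k)) (trans (cong (λ a → a ℕ.* a) (sym ∣n∣≡)) ‖n‖≡)))
  where
  odd² : ∀ k → suc (k + k) ℕ.* suc (k + k) ≡ suc ((k ℕ.* k + k ℕ.* k + k + k) + (k ℕ.* k + k ℕ.* k + k + k))
  odd² = ℕ-Solver.solve-∀

θ-term-quadruple : ∀ c j m → θ-term c ((j + j) + (j + j)) (ℤ.- (+ 2 ℤ.* m)) ≡ θ-term (+ 2 ℤ.* c) j m
θ-term-quadruple c j m = cong₂ _∧_ (%ℕ≡ᵇ0-cong 5 (mk⇔ to from)) ‖‖-part
  where
  to : + 5 ∣ (ℤ.- (+ 2 ℤ.* m) ℤ.- c) → + 5 ∣ (m ℤ.- + 2 ℤ.* c)
  to = λ 5∣ → ∣-combination (+ 2) (+ 0) m (eq₁ m c) 5∣ 5∣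
    where
    eq₁ : ∀ m c → m ℤ.- + 2 ℤ.* c ≡ + 2 ℤ.* (ℤ.- (+ 2 ℤ.* m) ℤ.- c) ℤ.+ + 0 ℤ.* (ℤ.- (+ 2 ℤ.* m) ℤ.- c) ℤ.+ m ℤ.* + 5
    eq₁ = solve-∀
  from : + 5 ∣ (m ℤ.- + 2 ℤ.* c) → + 5 ∣ (ℤ.- (+ 2 ℤ.* m) ℤ.- c)
  from = λ 5∣ → ∣-combination (ℤ.- + 2) (+ 0) (ℤ.- c) (eq₂ m c) 5∣ 5∣
    where
    eq₂ : ∀ m c → ℤ.- (+ 2 ℤ.* m) ℤ.- c ≡ ℤ.- + 2 ℤ.* (m ℤ.- + 2 ℤ.* c) ℤ.+ + 0 ℤ.* (m ℤ.- + 2 ℤ.* c) ℤ.+ ℤ.- c ℤ.* + 5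
    eq₂ = solve-∀
  ‖-2m‖ : ‖ ℤ.- (+ 2 ℤ.* m) ‖ ≡ (‖ m ‖ + ‖ m ‖) + (‖ m ‖ + ‖ m ‖)
  ‖-2m‖ = ℤ.+-injective (trans (+‖‖ (ℤ.- (+ 2 ℤ.* m))) (trans (square m) (cong (λ x → (x ℤ.+ x) ℤ.+ (x ℤ.+ x)) (sym (+‖‖ m)))))
    where
    square : ∀ m → ℤ.- (+ 2 ℤ.* m) ℤ.* ℤ.- (+ 2 ℤ.* m) ≡ (m ℤ.* m ℤ.+ m ℤ.* m) ℤ.+ (m ℤ.* m ℤ.+ m ℤ.* m)
    square = solve-∀
  ‖‖-part : (‖ ℤ.- (+ 2 ℤ.* m) ‖ ≡ᵇ (j + j) + (j + j)) ≡ (‖ m ‖ ≡ᵇ j)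
  ‖‖-part = trans (cong (_≡ᵇ (j + j) + (j + j)) ‖-2m‖) (trans (≡ᵇ-double (‖ m ‖ + ‖ m ‖) (j + j)) (≡ᵇ-double ‖ m ‖ j))

theta-quadruple : ∀ c j → theta c ((j + j) + (j + j)) ≡ theta (+ 2 ℤ.* c) j
theta-quadruple c j = begin
  theta c K                                 ≡⟨ theta-⨁ c K ⟩
  ⨁ (ℤrange K) (θ-term c K)                 ≡⟨ ⨁-reindex ℤ._≟_ φ (ℤrange-unique K) (ℤrange-unique j) φ-injective into onto ⟨
  ⨁[ m ∈ ℤrange j ] θ-term c K (φ m)        ≡⟨ ⨁-cong (λ {m} _ → θ-term-quadruple c j m) ⟩
  ⨁ (ℤrange j) (θ-term (+ 2 ℤ.* c) j)       ≡⟨ theta-⨁ (+ 2 ℤ.* c) j ⟨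
  theta (+ 2 ℤ.* c) j                       ∎
  where
  open ≡-Reasoning
  K : ℕ
  K = (j + j) + (j + j)
  φ : ℤ → ℤ
  φ m = ℤ.- (+ 2 ℤ.* m)
  φ-injective : ∀ {m m′} → m ∈ ℤrange j → m′ ∈ ℤrange j → φ m ≡ φ m′ → m ≡ m′
  φ-injective {m} {m′} _ _ eq = ℤ.*-cancelˡ-≡ (+ 2) m m′ (ℤ.neg-injective eq)
  into : ∀ {m} → m ∈ ℤrange j → T (θ-term c K (φ m)) → φ m ∈ ℤrange K
  into {m} _ t = ∈-ℤrange (≤-reflexive (T-θ-term⇒‖‖ c K (φ m) t))
  onto : ∀ {n} → n ∈ ℤrange K → T (θ-term c K n) → ∃[ m ] m ∈ ℤrange j × φ m ≡ n
  onto {n} _ t with 2∣²⇒2∣ n (subst (+ 2 ∣_) (trans (cong +_ (sym (T-θ-term⇒‖‖ c K n t))) (+‖‖ n)) (2∣-double (j + j)))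
  ... | divides q refl = ℤ.- q , ∈-ℤrange (≤-reflexive (T-θ-term⇒‖‖ (+ 2 ℤ.* c) j (ℤ.- q) t′)) , φ[-q]≡q*2 q
    where
    φ[-q]≡q*2 : ∀ q → ℤ.- (+ 2 ℤ.* ℤ.- q) ≡ q ℤ.* + 2
    φ[-q]≡q*2 = solve-∀
    t′ : T (θ-term (+ 2 ℤ.* c) j (ℤ.- q))
    t′ = subst T (θ-term-quadruple c j (ℤ.- q)) (subst (T ∘ θ-term c K) (sym (φ[-q]≡q*2 q)) t)

theta-quadruple+2 : ∀ c j → theta c (suc (j + j) + suc (j + j)) ≡ false
theta-quadruple+2 c j = trans (theta-⨁ c _) (⨁-false λ {n} _ t → ‖‖≢4j+2 n j (T-θ-term⇒‖‖ c _ n t))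

Ev-theta : ∀ c → Ev (theta c) ≈ sq (theta (+ 2 ℤ.* c))
Ev-theta c k with parity k
... | j , inj₁ refl = trans (theta-quadruple c j) (sym (sq-double (theta (+ 2 ℤ.* c)) j))
... | j , inj₂ refl = trans (theta-quadruple+2 c j) (sym (sq-odd (theta (+ 2 ℤ.* c)) j))

ℤ²range : ℕ → List (ℤ × ℤ)
ℤ²range N = cartesianProduct (ℤrange N) (ℤrange N)

θ²-term : ℤ → ℤ → ℕ → ℤ × ℤ → Bool
θ²-term c c′ N (s , t) = ((s ≡₅ c) ∧ (t ≡₅ c′)) ∧ (‖ s ‖ + ‖ t ‖ ≡ᵇ N)

theta-⊛-⨁ : ∀ c c′ N → (theta c ⊛ theta c′) N ≡ ⨁ (ℤ²range N) (θ²-term c c′ N)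
theta-⊛-⨁ c c′ N = ⊛-sparse (ℤrange N) (ℤrange N) (_≡₅ c) (_≡₅ c′) ‖_‖ ‖_‖ N (theta-⨁-extend c) (theta-⨁-extend c′)

T-θ²-term⇒‖‖ : ∀ c c′ N s t → T (θ²-term c c′ N (s , t)) → ‖ s ‖ + ‖ t ‖ ≡ N
T-θ²-term⇒‖‖ c c′ N s t h = ≡ᵇ⇒≡ _ N (proj₂ (T-∧⁻ ((s ≡₅ c) ∧ (t ≡₅ c′)) h))

∈-ℤ²range : ∀ {s t N} → ‖ s ‖ + ‖ t ‖ ≡ N → (s , t) ∈ ℤ²range N
∈-ℤ²range {s} {t} eq = ∈-cartesianProduct⁺ (∈-ℤrange (subst (‖ s ‖ ≤_) eq (m≤m+n _ _))) (∈-ℤrange (subst (‖ t ‖ ≤_) eq (m≤n+m _ _)))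

rotate : ℤ × ℤ → ℤ × ℤ
rotate (u , v) = (v ℤ.- u , ℤ.- u ℤ.- v)

θ²-term-rotate : ∀ c n u v → θ²-term c (+ 2 ℤ.* c) (n + n) (rotate (u , v)) ≡ θ²-term c (+ 2 ℤ.* c) n (u , v)
θ²-term-rotate c n u v = cong₂ _∧_ residues norms
  where
  open Equivalence
  c′ : ℤ
  c′ = + 2 ℤ.* c

  rotated⇒original : (+ 5 ∣ (v ℤ.- u ℤ.- c)) × (+ 5 ∣ (ℤ.- u ℤ.- v ℤ.- c′)) → (+ 5 ∣ (u ℤ.- c)) × (+ 5 ∣ (v ℤ.- c′))
  rotated⇒original (5∣a , 5∣b) = ∣-combination (+ 2) (+ 2) (u ℤ.+ c) (eq u v c) 5∣a 5∣b
                               , ∣-combination (+ 3) (ℤ.- + 3) (ℤ.- (v ℤ.+ c)) (eq′ u v c) 5∣a 5∣b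
    where
    eq : ∀ u v c → u ℤ.- c ≡ + 2 ℤ.* (v ℤ.- u ℤ.- c) ℤ.+ + 2 ℤ.* (ℤ.- u ℤ.- v ℤ.- + 2 ℤ.* c) ℤ.+ (u ℤ.+ c) ℤ.* + 5
    eq = solve-∀
    eq′ : ∀ u v c → v ℤ.- + 2 ℤ.* c ≡ + 3 ℤ.* (v ℤ.- u ℤ.- c) ℤ.+ ℤ.- + 3 ℤ.* (ℤ.- u ℤ.- v ℤ.- + 2 ℤ.* c) ℤ.+ ℤ.- (v ℤ.+ c) ℤ.* + 5
    eq′ = solve-∀

  original⇒rotated : (+ 5 ∣ (u ℤ.- c)) × (+ 5 ∣ (v ℤ.- c′)) → (+ 5 ∣ (v ℤ.- u ℤ.- c)) × (+ 5 ∣ (ℤ.- u ℤ.- v ℤ.- c′))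
  original⇒rotated (5∣a , 5∣b) = ∣-combination (ℤ.- + 1) (+ 1) (+ 0) (eq u v c) 5∣a 5∣b
                               , ∣-combination (ℤ.- + 1) (ℤ.- + 1) (ℤ.- c) (eq′ u v c) 5∣a 5∣b
    where
    eq : ∀ u v c → v ℤ.- u ℤ.- c ≡ ℤ.- + 1 ℤ.* (u ℤ.- c) ℤ.+ + 1 ℤ.* (v ℤ.- + 2 ℤ.* c) ℤ.+ + 0 ℤ.* + 5
    eq = solve-∀
    eq′ : ∀ u v c → ℤ.- u ℤ.- v ℤ.- + 2 ℤ.* c ≡ ℤ.- + 1 ℤ.* (u ℤ.- c) ℤ.+ ℤ.- + 1 ℤ.* (v ℤ.- + 2 ℤ.* c) ℤ.+ ℤ.- c ℤ.* + 5
    eq′ = solve-∀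

  residues : ((v ℤ.- u ≡₅ c) ∧ (ℤ.- u ℤ.- v ≡₅ c′)) ≡ ((u ≡₅ c) ∧ (v ≡₅ c′))
  residues = T⇔T⇒≡ (mk⇔ (from (T-≡₅-∧ u v c c′) ∘ rotated⇒original ∘ to (T-≡₅-∧ (v ℤ.- u) (ℤ.- u ℤ.- v) c c′))
                        (from (T-≡₅-∧ (v ℤ.- u) (ℤ.- u ℤ.- v) c c′) ∘ original⇒rotated ∘ to (T-≡₅-∧ u v c c′)))

  ‖rotate‖ : ‖ v ℤ.- u ‖ + ‖ ℤ.- u ℤ.- v ‖ ≡ (‖ u ‖ + ‖ v ‖) + (‖ u ‖ + ‖ v ‖)
  ‖rotate‖ = ℤ.+-injective (begin
    + (‖ v ℤ.- u ‖ + ‖ ℤ.- u ℤ.- v ‖)                          ≡⟨ ℤ.pos-+ ‖ v ℤ.- u ‖ _ ⟩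
    + ‖ v ℤ.- u ‖ ℤ.+ + ‖ ℤ.- u ℤ.- v ‖                        ≡⟨ cong₂ ℤ._+_ (+‖‖ (v ℤ.- u)) (+‖‖ (ℤ.- u ℤ.- v)) ⟩
    (v ℤ.- u) ℤ.* (v ℤ.- u) ℤ.+ (ℤ.- u ℤ.- v) ℤ.* (ℤ.- u ℤ.- v) ≡⟨ squares u v ⟩
    (u ℤ.* u ℤ.+ v ℤ.* v) ℤ.+ (u ℤ.* u ℤ.+ v ℤ.* v)             ≡⟨ cong (λ x → x ℤ.+ x) (cong₂ ℤ._+_ (+‖‖ u) (+‖‖ v)) ⟨
    (+ ‖ u ‖ ℤ.+ + ‖ v ‖) ℤ.+ (+ ‖ u ‖ ℤ.+ + ‖ v ‖)             ∎)
    where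
    open ≡-Reasoning
    squares : ∀ u v → (v ℤ.- u) ℤ.* (v ℤ.- u) ℤ.+ (ℤ.- u ℤ.- v) ℤ.* (ℤ.- u ℤ.- v) ≡ (u ℤ.* u ℤ.+ v ℤ.* v) ℤ.+ (u ℤ.* u ℤ.+ v ℤ.* v)
    squares = solve-∀
  norms : (‖ v ℤ.- u ‖ + ‖ ℤ.- u ℤ.- v ‖ ≡ᵇ n + n) ≡ (‖ u ‖ + ‖ v ‖ ≡ᵇ n)
  norms = trans (cong (_≡ᵇ n + n) ‖rotate‖) (≡ᵇ-double (‖ u ‖ + ‖ v ‖) n)

Ev-theta-⊛ : ∀ c → Ev (theta c ⊛ theta (+ 2 ℤ.* c)) ≈ theta c ⊛ theta (+ 2 ℤ.* c)
Ev-theta-⊛ c n = begin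
  (theta c ⊛ theta c′) (n + n)                  ≡⟨ theta-⊛-⨁ c c′ (n + n) ⟩
  ⨁ (ℤ²range (n + n)) (θ²-term c c′ (n + n))    ≡⟨ ⨁-reindex (≡-dec ℤ._≟_ ℤ._≟_) rotate (!ℤ²range (n + n)) (!ℤ²range n)
                                                     rotate-injective into onto ⟨
  ⨁[ uv ∈ ℤ²range n ] θ²-term c c′ (n + n) (rotate uv) ≡⟨ ⨁-cong (λ {uv} _ → θ²-term-rotate c n (proj₁ uv) (proj₂ uv)) ⟩
  ⨁ (ℤ²range n) (θ²-term c c′ n)                ≡⟨ theta-⊛-⨁ c c′ n ⟨
  (theta c ⊛ theta c′) n                        ∎
  where
  open ≡-Reasoning
  c′ : ℤ
  c′ = + 2 ℤ.* c
  !ℤ²range : ∀ N → Unique (ℤ²range N)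
  !ℤ²range N = cartesianProduct⁺ (ℤrange-unique N) (ℤrange-unique N)

  rotate-injective : ∀ {uv uv′} → uv ∈ ℤ²range n → uv′ ∈ ℤ²range n → rotate uv ≡ rotate uv′ → uv ≡ uv′
  rotate-injective {u , v} {u′ , v′} _ _ eq with ,-injective eq
  ... | e₁ , e₂ = cong₂ _,_ (ℤ.*-cancelʳ-≡ u u′ (+ 2) (trans (u*2 u v) (trans (cong₂ (λ x y → ℤ.- (x ℤ.+ y)) e₁ e₂) (sym (u*2 u′ v′)))))
                            (ℤ.*-cancelʳ-≡ v v′ (+ 2) (trans (v*2 u v) (trans (cong₂ ℤ._-_ e₁ e₂) (sym (v*2 u′ v′)))))
    where
    u*2 : ∀ u v → u ℤ.* + 2 ≡ ℤ.- ((v ℤ.- u) ℤ.+ (ℤ.- u ℤ.- v))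
    u*2 = solve-∀
    v*2 : ∀ u v → v ℤ.* + 2 ≡ (v ℤ.- u) ℤ.- (ℤ.- u ℤ.- v)
    v*2 = solve-∀

  into : ∀ {uv} → uv ∈ ℤ²range n → T (θ²-term c c′ (n + n) (rotate uv)) → rotate uv ∈ ℤ²range (n + n)
  into {u , v} _ h = ∈-ℤ²range (T-θ²-term⇒‖‖ c c′ (n + n) (v ℤ.- u) (ℤ.- u ℤ.- v) h)

  onto : ∀ {st} → st ∈ ℤ²range (n + n) → T (θ²-term c c′ (n + n) st) → ∃[ uv ] uv ∈ ℤ²range n × rotate uv ≡ st
  onto {s , t} _ h with 2∣²⇒2∣ (s ℤ.+ t) (∣-combination (+ 1) (s ℤ.* t) (+ 0) (square s t) 2∣s²+t² ∣-refl)
    where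
    2∣s²+t² : + 2 ∣ (s ℤ.* s ℤ.+ t ℤ.* t)
    2∣s²+t² = subst (+ 2 ∣_) (trans (cong +_ (sym (T-θ²-term⇒‖‖ c c′ (n + n) s t h)))
                (trans (ℤ.pos-+ ‖ s ‖ ‖ t ‖) (cong₂ ℤ._+_ (+‖‖ s) (+‖‖ t)))) (2∣-double n)
    square : ∀ s t → (s ℤ.+ t) ℤ.* (s ℤ.+ t) ≡ + 1 ℤ.* (s ℤ.* s ℤ.+ t ℤ.* t) ℤ.+ (s ℤ.* t) ℤ.* + 2 ℤ.+ + 0 ℤ.* + 2
    square = solve-∀
  ... | divides q s+t≡q*2 = uv , ∈-ℤ²range (T-θ²-term⇒‖‖ c c′ n (ℤ.- q) (q ℤ.- t) h′) , rotate-uv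
    where
    uv : ℤ × ℤ
    uv = ℤ.- q , q ℤ.- t
    rotate-uv : rotate uv ≡ (s , t)
    rotate-uv = cong₂ _,_ (trans (first q t) (trans (cong (ℤ._- t) (sym s+t≡q*2)) (cancel s t))) (second q t)
      where
      first : ∀ q t → (q ℤ.- t) ℤ.- ℤ.- q ≡ q ℤ.* + 2 ℤ.- t
      first = solve-∀
      cancel : ∀ s t → (s ℤ.+ t) ℤ.- t ≡ s
      cancel = solve-∀
      second : ∀ q t → ℤ.- ℤ.- q ℤ.- (q ℤ.- t) ≡ t
      second = solve-∀
    h′ : T (θ²-term c c′ n uv)
    h′ = subst T (θ²-term-rotate c n (ℤ.- q) (q ℤ.- t)) (subst (T ∘ θ²-term c c′ (n + n)) (sym rotate-uv) h)

-- The implicit arguments of cong are explicit because inferring them would unfold theta c ^ᵖ 16.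
theorem4p1 : (r : ℕ) → (r ≡ 1 ⊎ r ≡ 2) →
    (m : ℕ) (f : PS) →
    (∀ n → (theta (+ r) ⊛ f) n ≡ X^ m n) →
    ∀ (e : ℤ) → proj 8 0 (shiftLS m f) e ≡ psToLS (theta (+ (2 * r)) ^ᵖ 16) e
theorem4p1 r _ m f a·f≡xᵐ e = begin
  proj 8 0 (shiftLS m f) e                  ≡⟨ Reciprocal.proj-reciprocal (theta (+ r)) (theta (+ 2 ℤ.* + r)) f m
                                                 a·f≡xᵐ (Ev-theta (+ r)) (Ev-theta-⊛ (+ r)) e ⟩
  psToLS (sq (sq (sq (sq (theta (+ 2 ℤ.* + r)))))) e ≡⟨ psToLS-cong (^ᵖ16≈sq⁴ (theta (+ 2 ℤ.* + r))) e ⟨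
  psToLS (theta (+ 2 ℤ.* + r) ^ᵖ 16) e      ≡⟨ cong (λ c → psToLS (theta c ^ᵖ 16) e) {x = + (2 * r)} {y = + 2 ℤ.* + r} (ℤ.pos-* 2 r) ⟨
  psToLS (theta (+ (2 * r)) ^ᵖ 16) e        ∎
  where open ≡-Reasoning
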